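{- Consider an instance $G=(V,E\cup\overrightarrow{T})$ of Tree Augmentation. Partition $E$ into back edges $B$ and cross edges $C$; let $\overrightarrow{B}$ orient each back edge from descendant to ancestor; fix a depth-first search of $T$ from the root and let $\overrightarrow{C}$ orient each cross edge from lower to higher pre-order and $\overleftarrow{C}$ be the reverse orientation. Then whichever of the two orientations $\overrightarrow{B}\cup\overrightarrow{C}$ and $\overrightarrow{B}\cup\overleftarrow{C}$ covers more vertices is a feasible solution covering at least $\frac12$ of the maximum number of vertices covered by any feasible solution (i.e., it is a $\frac12$-approximation).
   Context: Tree Augmentation: the input is a mixed graph $G=(V,E\cup\overrightarrow{T})$ where $E$ is a set of undirected edges and $\overrightarrow{T}$ is a set of arcs forming a spanning tree of $V$ with all arcs directed towards a root (destination) vertex $d$. A feasible solution is an orientation $\overrightarrow{E'}$ of a subset $E'\subseteq E$ such that $(V,\overrightarrow{T}\cup\overrightarrow{E'})$ is acyclic. A vertex $u$ is covered if $\overrightarrow{E'}$ contains an arc $\overrightarrow{uv}$ leaving $u$. The objective is to maximize the number of covered vertices. Back edges are edges $uv\in E$ where one endpoint is a descendant of the other in the rooted tree $T$; cross edges are the remaining edges of $E$. Pre-order is the order in which the depth-first search first visits vertices. -}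

module Defs where

open import Data.Nat using (ℕ; zero; suc; _≤_; _≤ᵇ_; _*_)
open import Data.Fin using (Fin)
open import Data.Fin.Properties using (_≟_)
open import Data.Bool using (if_then_else_; true; false)
open import Data.List using (List; []; _∷_; _++_; length; filter; allFin)
open import Data.List.Relation.Unary.Any using (any?)
open import Data.List.Relation.Binary.Permutation.Propositional using (_↭_)
open import Data.List.Relation.Binary.Pointwise using (Pointwise)
open import Data.List.Membership.Propositional using (_∈_)
open import Data.Product using (Σ; ∃; ∃-syntax; _×_; _,_; proj₁)
open import Data.Sum using (_⊎_)
open import Function using (_∘_)
open import Relation.Nullary using (¬_)
open import Relation.Nullary.Decidable using (_×-dec_; ¬?)
open import Relation.Binary.PropositionalEquality using (_≡_; _≢_)
open import Relation.Binary.Construct.Closure.Transitive using (TransClosure)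

iter : ∀ {A : Set} → (A → A) → ℕ → A → A
iter f zero    x = x
iter f (suc k) x = f (iter f k x)

-- The spanning in-tree T has root d; every vertex v ≢ d has the tree arc v → par v.
-- (par d ≡ d is a convention; no arc leaves d.)  Every vertex reaches d along
-- parent pointers, so the arcs form a spanning tree directed towards d.
-- E is the list of undirected edges, each given as an (unordered) pair of endpoints.
record Instance (n : ℕ) : Set where
  field
    d       : Fin n
    par     : Fin n → Fin n
    par-d   : par d ≡ d
    reach   : ∀ v → ∃[ k ] iter par k v ≡ d
    E       : List (Fin n × Fin n)
    noLoop  : ∀ {u v} → (u , v) ∈ E → u ≢ v

module _ {n : ℕ} (G : Instance n) where
  open Instance G

  Arc : Set
  Arc = Fin n × Fin n

  TreeArc : Fin n → Fin n → Set
  TreeArc u v = u ≢ d × par u ≡ v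

  Desc : Fin n → Fin n → Set
  Desc u v = ∃[ k ] iter par k u ≡ v

  IsBack : Fin n → Fin n → Set
  IsBack u v = Desc u v ⊎ Desc v u

  IsCross : Fin n → Fin n → Set
  IsCross u v = ¬ IsBack u v

  children : Fin n → List (Fin n)
  children v = filter (λ c → ¬? (c ≟ d) ×-dec (par c ≟ v)) (allFin n)

  -- DFS v L : L is the pre-order (first-visit order) of a depth-first search
  -- of the subtree of T rooted at v, the children of each vertex being visited in
  -- some order.
  mutual
    data DFS (v : Fin n) : List (Fin n) → Set where
      visit : ∀ {cs L} → cs ↭ children v → DFSSeq cs L → DFS v (v ∷ L)

    data DFSSeq : List (Fin n) → List (Fin n) → Set where
      []  : DFSSeq [] []
      _∷_ : ∀ {c cs L Ls} → DFS c L → DFSSeq cs Ls → DFSSeq (c ∷ cs) (L ++ Ls)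

  Before : List (Fin n) → Fin n → Fin n → Set
  Before L u v = Σ (List (Fin n)) λ xs → Σ (List (Fin n)) λ ys →
                   L ≡ xs ++ (u ∷ ys) × v ∈ ys

  -- Orientation rules.  An edge uv may be oriented u → v ...
  -- in B→ ∪ C→ : back edges descendant→ancestor, cross edges lower→higher pre-order
  RuleFwd : List (Fin n) → Fin n → Fin n → Set
  RuleFwd L u v = (IsBack u v × Desc u v) ⊎ (IsCross u v × Before L u v)

  -- in B→ ∪ C← : back edges descendant→ancestor, cross edges higher→lower pre-order
  RuleBwd : List (Fin n) → Fin n → Fin n → Set
  RuleBwd L u v = (IsBack u v × Desc u v) ⊎ (IsCross u v × Before L v u)

  Oriented : (Fin n → Fin n → Set) → Fin n × Fin n → Arc → Set
  Oriented R (u , v) a = (a ≡ (u , v) × R u v) ⊎ (a ≡ (v , u) × R v u)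

  OrientAll : (Fin n → Fin n → Set) → List Arc → Set
  OrientAll R A = Pointwise (Oriented R) E A

  Step : List Arc → Fin n → Fin n → Set
  Step A u v = TreeArc u v ⊎ (u , v) ∈ A

  Acyclic : List Arc → Set
  Acyclic A = ∀ u → ¬ TransClosure (Step A) u u

  Feasible : List Arc → Set
  Feasible A = (∀ {u v} → (u , v) ∈ A → (u , v) ∈ E ⊎ (v , u) ∈ E) × Acyclic A

  -- number of covered vertices (vertices with an outgoing arc of A)
  coveredCount : List Arc → ℕ
  coveredCount A =
    length (filter (λ u → any? (λ a → proj₁ a ≟ u) A) (allFin n))

  better : List Arc → List Arc → List Arc
  better A₁ A₂ = if coveredCount A₂ ≤ᵇ coveredCount A₁ then A₁ else A₂

module Submission where

-- The two candidate orientations are feasible, and together they cover every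
-- vertex that any feasible solution covers; hence the better of the two covers
-- at least half of the optimum.
--
--  * B→ ∪ C← : every tree arc and every oriented edge points to a vertex that is
--    strictly earlier in pre-order, so the pre-order position is a strictly
--    decreasing rank and T ∪ B→ ∪ C← is acyclic.
--  * B→ ∪ C→ : let end(u) be the position just after the pre-order block of the
--    subtree of u.  Tree and back arcs (descendant → ancestor) do not decrease
--    end and strictly decrease the position; a cross arc u → v with u earlier
--    than v strictly increases end (the subtree of u is finished before v).
--    So (end , position), ordered lexicographically, is a strictly increasing rank.
--  * If a feasible A contains u → v but neither candidate covers u, both
--    candidates orient uv as v → u: for a back edge v is then a descendant of u and
--    the tree path v ⇝ u closes a cycle with u → v; for a cross edge the two
--    candidates contradict each other.  A union bound on covered vertices finishes.

open import Defs
open import Data.Nat using (ℕ; zero; suc; _+_; _∸_; _≤_; _<_; _>_; _*_; _≤ᵇ_; z≤n; s≤s)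
open import Data.Nat.Properties
  using (≤-refl; ≤-trans; <-trans; <-irrefl; <-asym; ≤-<-trans; <-≤-trans; <⇒≤; <⇒≱; ≰⇒>; ≤-total;
         m≤m+n; n≤1+n; +-suc; +-comm; +-identityʳ; +-mono-≤; +-monoʳ-≤; +-monoˡ-≤; m∸n+n≡m;
         m≤n⇒m<n∨m≡n; ≤ᵇ⇒≤; ≤⇒≤ᵇ; module ≤-Reasoning)
open import Data.Fin using (Fin)
open import Data.Fin.Properties using (_≟_)
open import Data.List using (List; []; _∷_; _++_; length; filter; allFin)
open import Data.List.Properties using (++-assoc; length-++; ++-identityʳ; filter-accept)
open import Data.List.Relation.Unary.Any using (Any; here; there; any?)
import Data.List.Relation.Unary.Any as Any
import Data.List.Relation.Unary.All as All
open import Data.List.Relation.Unary.All.Properties.Core using (¬Any⇒All¬)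
open import Data.List.Relation.Unary.AllPairs using ([]; _∷_)
open import Data.List.Relation.Unary.Unique.Propositional using (Unique)
import Data.List.Relation.Unary.Unique.Propositional.Properties as Unique
open import Data.List.Relation.Binary.Permutation.Propositional using (↭-sym; ↭⇒↭ₛ)
open import Data.List.Relation.Binary.Permutation.Propositional.Properties using (∈-resp-↭)
open import Data.List.Relation.Binary.Permutation.Setoid.Properties using (Unique-resp-↭)
open import Data.List.Relation.Binary.Pointwise using (Pointwise; []; _∷_)
import Data.List.Relation.Binary.Pointwise as Pointwise
open import Data.List.Membership.Propositional using (_∈_; _∉_; find)
open import Data.List.Membership.Propositional.Properties
  using (∈-filter⁺; ∈-filter⁻; ∈-allFin; ∈-++⁺ˡ; ∈-++⁺ʳ; ∈-++⁻)
open import Data.Product using (Σ; _×_; _,_; proj₁; proj₂)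
open import Data.Product.Relation.Binary.Lex.Strict using (×-Lex; ×-transitive; ×-irreflexive)
open import Data.Sum using (_⊎_; inj₁; inj₂)
open import Data.Bool using (true; false; T)
open import Data.Unit using (tt)
open import Data.Empty using (⊥; ⊥-elim)
open import Function using (_∘_)
open import Relation.Nullary using (¬_; yes; no)
open import Relation.Nullary.Decidable using (_×-dec_; ¬?)
open import Relation.Unary using (Decidable)
open import Relation.Binary.Definitions using (DecidableEquality)
open import Relation.Binary.PropositionalEquality
  using (_≡_; _≢_; refl; sym; trans; cong; subst; setoid; isEquivalence; resp₂; module ≡-Reasoning)
open import Relation.Binary.Construct.Closure.Transitive using (TransClosure; [_]; _∷_; _∷ʳ_)

iter-+ : ∀ {A : Set} (f : A → A) m k x → iter f (m + k) x ≡ iter f m (iter f k x)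
iter-+ f zero    k x = refl
iter-+ f (suc m) k x = cong f (iter-+ f m k x)

iter-swap : ∀ {A : Set} (f : A → A) k x → iter f k (f x) ≡ f (iter f k x)
iter-swap f zero    x = refl
iter-swap f (suc k) x = cong f (iter-swap f k x)

iter-fixed : ∀ {A : Set} (f : A → A) {y} → f y ≡ y → ∀ k → iter f k y ≡ y
iter-fixed f fy zero    = refl
iter-fixed f fy (suc k) = trans (cong f (iter-fixed f fy k)) fy

-- A periodic point of f from which f reaches a fixed point is that fixed point.
-- (For the parent map this says: T has no cycles other than the loop at the root.)
periodic-fixed : ∀ {A : Set} (f : A → A) p r {x y} →
                 iter f (suc p) x ≡ x → f y ≡ y → iter f r x ≡ y → x ≡ y
periodic-fixed f p zero    per fy reach = reach
periodic-fixed f p (suc r) {x} {y} per fy reach = begin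
  x                    ≡⟨ sym per ⟩
  iter f (suc p) x     ≡⟨ sym (iter-swap f p x) ⟩
  iter f p (f x)       ≡⟨ cong (iter f p) fx≡y ⟩
  iter f p y           ≡⟨ iter-fixed f fy p ⟩
  y                    ∎
  where
    open ≡-Reasoning
    fx-periodic : iter f (suc p) (f x) ≡ f x
    fx-periodic = trans (cong f (iter-swap f p x)) (cong f per)
    fx≡y : f x ≡ y
    fx≡y = periodic-fixed f p r fx-periodic fy (trans (iter-swap f r x) reach)

module Rank {A B : Set} (S : A → A → Set) (_≺_ : B → B → Set) (rank : A → B)
            (≺-trans : ∀ {a b c} → a ≺ b → b ≺ c → a ≺ c)
            (step : ∀ {x y} → S x y → rank x ≺ rank y) where

  rank-increases : ∀ {x y} → TransClosure S x y → rank x ≺ rank y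
  rank-increases [ s ] = step s
  rank-increases (s ∷ ss) = ≺-trans (step s) (rank-increases ss)

  rank-acyclic : (∀ {b} → ¬ b ≺ b) → ∀ x → ¬ TransClosure S x x
  rank-acyclic ≺-irrefl x cycle = ≺-irrefl (rank-increases cycle)

module Counting {X : Set} where

  count-grows : ∀ {P : X → Set} (P? : Decidable P) x xs →
                length (filter P? xs) ≤ length (filter P? (x ∷ xs))
  count-grows P? x xs with P? x
  ... | yes _ = n≤1+n _
  ... | no  _ = ≤-refl

  count-∪ : ∀ {P Q R : X → Set} (P? : Decidable P) (Q? : Decidable Q) (R? : Decidable R) →
            (∀ {x} → P x → Q x ⊎ R x) →
            ∀ xs → length (filter P? xs) ≤ length (filter Q? xs) + length (filter R? xs)
  count-∪ P? Q? R? P⊆Q∪R [] = z≤n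
  count-∪ P? Q? R? P⊆Q∪R (x ∷ xs) with P? x
  ... | no _ = ≤-trans ih (+-mono-≤ (count-grows Q? x xs) (count-grows R? x xs))
    where ih = count-∪ P? Q? R? P⊆Q∪R xs
  ... | yes p with P⊆Q∪R p
  ...   | inj₁ q = begin
    suc #P                              ≤⟨ s≤s (≤-trans ih (+-monoʳ-≤ #Q (count-grows R? x xs))) ⟩
    suc (#Q + #R′)                       ≡⟨ cong (λ l → length l + #R′) (sym (filter-accept Q? q)) ⟩
    length (filter Q? (x ∷ xs)) + #R′    ∎
    where
      open ≤-Reasoning
      ih = count-∪ P? Q? R? P⊆Q∪R xs
      #P = length (filter P? xs)
      #Q = length (filter Q? xs)
      #R′ = length (filter R? (x ∷ xs))
  ...   | inj₂ r = begin
    suc #P                              ≤⟨ s≤s (≤-trans ih (+-monoˡ-≤ #R (count-grows Q? x xs))) ⟩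
    suc (#Q′ + #R)                       ≡⟨ sym (+-suc #Q′ #R) ⟩
    #Q′ + suc #R                         ≡⟨ cong (λ l → #Q′ + length l) (sym (filter-accept R? r)) ⟩
    #Q′ + length (filter R? (x ∷ xs))    ∎
    where
      open ≤-Reasoning
      ih = count-∪ P? Q? R? P⊆Q∪R xs
      #P = length (filter P? xs)
      #R = length (filter R? xs)
      #Q′ = length (filter Q? (x ∷ xs))

open Counting using (count-∪)

module Position {A : Set} (_≟ₐ_ : DecidableEquality A) where

  -- index of the first occurrence of x (the length of the list if x is absent)
  pos : A → List A → ℕ
  pos x []       = 0
  pos x (y ∷ ys) with x ≟ₐ y
  ... | yes _ = 0
  ... | no  _ = suc (pos x ys)

  pos-++-∉ : ∀ {x} (P Q : List A) → x ∉ P → pos x (P ++ Q) ≡ length P + pos x Q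
  pos-++-∉ []      Q x∉P = refl
  pos-++-∉ {x} (y ∷ P) Q x∉P with x ≟ₐ y
  ... | yes x≡y = ⊥-elim (x∉P (here x≡y))
  ... | no  _   = cong suc (pos-++-∉ P Q (x∉P ∘ there))

  pos-prefix : ∀ {x} (P Q : List A) → x ∈ P → pos x (P ++ Q) < length P
  pos-prefix {x} (y ∷ P) Q x∈P with x ≟ₐ y | x∈P
  ... | yes _  | _         = s≤s z≤n
  ... | no x≢y | here x≡y  = ⊥-elim (x≢y x≡y)
  ... | no _   | there x∈P = s≤s (pos-prefix P Q x∈P)

  unique-disjoint : ∀ {x} (P : List A) {Q : List A} → Unique (P ++ Q) → x ∈ Q → x ∉ P
  unique-disjoint (y ∷ P) (y∉ ∷ _) x∈Q (here refl) =
    All.lookup y∉ (∈-++⁺ʳ P x∈Q) refl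
  unique-disjoint (y ∷ P) (_ ∷ u) x∈Q (there x∈P) = unique-disjoint P u x∈Q x∈P

  pos-suffix : ∀ {x} (P Q : List A) → Unique (P ++ Q) → x ∈ Q → length P ≤ pos x (P ++ Q)
  pos-suffix {x} P Q u x∈Q =
    subst (length P ≤_) (sym (pos-++-∉ P Q (unique-disjoint P u x∈Q))) (m≤m+n (length P) (pos x Q))

  before-pos : ∀ {L x y} (P Q : List A) → Unique L → L ≡ P ++ x ∷ Q → y ∈ Q → pos x L < pos y L
  before-pos {x = x} {y} P Q u refl y∈Q =
    subst (λ l → pos x l < pos y l) split
      (<-≤-trans (pos-prefix (P ++ (x ∷ [])) Q (∈-++⁺ʳ P (here refl))) (pos-suffix (P ++ (x ∷ [])) Q u′ y∈Q))
    where
      split : (P ++ (x ∷ [])) ++ Q ≡ P ++ x ∷ Q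
      split = ++-assoc P (x ∷ []) Q
      u′ : Unique ((P ++ (x ∷ [])) ++ Q)
      u′ = subst Unique (sym split) u

  block-end : ∀ {L} (P S Q : List A) {K} → Unique L → L ≡ P ++ S ++ Q →
              (∀ {x} → x ∈ S → pos x L < K) → length P ≤ K → length (P ++ S) ≤ K
  block-end P [] Q {K} u split below P≤K = subst (_≤ K) (cong length (sym (++-identityʳ P))) P≤K
  block-end {L} P (s ∷ S) Q {K} u split below P≤K =
    subst (_≤ K) (cong length (++-assoc P (s ∷ []) S))
          (block-end (P ++ (s ∷ [])) S Q u split′ (below ∘ there) Ps≤K)
    where
      split′ : L ≡ (P ++ (s ∷ [])) ++ S ++ Q
      split′ = trans split (sym (++-assoc P (s ∷ []) (S ++ Q)))
      s-after-P : length P ≤ pos s L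
      s-after-P = subst (λ l → length P ≤ pos s l) (sym split)
                        (pos-suffix P (s ∷ S ++ Q) (subst Unique split u) (here refl))
      Ps≤K : length (P ++ (s ∷ [])) ≤ K
      Ps≤K = subst (_≤ K) (sym (trans (length-++ P) (+-comm (length P) 1)))
                   (≤-<-trans s-after-P (below (here refl)))

pointwise-∈ : ∀ {X Y : Set} {R : X → Y → Set} {xs ys y} → Pointwise R xs ys → y ∈ ys →
              Σ X (λ x → x ∈ xs × R x y)
pointwise-∈ (r ∷ rs) (here refl) = _ , here refl , r
pointwise-∈ (r ∷ rs) (there y∈) with pointwise-∈ rs y∈
... | x , x∈ , r′ = x , there x∈ , r′

module Tree {n : ℕ} (G : Instance n) where
  open Instance G

  V : Set
  V = Fin n

  par-moves : ∀ {u} → u ≢ d → par u ≢ u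
  par-moves {u} u≢d pu≡u = u≢d (periodic-fixed par 0 (proj₁ (reach u)) pu≡u par-d (proj₂ (reach u)))

  tree-arc-desc : ∀ {u v} → TreeArc G u v → Desc G u v
  tree-arc-desc (_ , pu≡v) = 1 , pu≡v

  tree-arc-proper : ∀ {u v} → TreeArc G u v → u ≢ v
  tree-arc-proper {u} (u≢d , pu≡v) u≡v = par-moves u≢d (trans pu≡v (sym u≡v))

  Desc-trans : ∀ {x u v} → Desc G x u → Desc G u v → Desc G x v
  Desc-trans {x} (k , xk≡u) (m , um≡v) =
    m + k , trans (iter-+ par m k x) (trans (cong (iter par m) xk≡u) um≡v)

  -- a vertex that is both ancestor and descendant of b lies on a cycle of par,
  -- so by periodic-fixed it is the root, and then b is the root too
  Desc-antisym : ∀ {a b} → Desc G a b → Desc G b a → a ≡ b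
  Desc-antisym (zero , a≡b) _ = a≡b
  Desc-antisym {a} {b} (suc k , ak≡b) (m , bm≡a) = begin
    a                    ≡⟨ a≡d ⟩
    d                    ≡⟨ sym (iter-fixed par par-d (suc k)) ⟩
    iter par (suc k) d   ≡⟨ cong (iter par (suc k)) (sym a≡d) ⟩
    iter par (suc k) a   ≡⟨ ak≡b ⟩
    b                    ∎
    where
      open ≡-Reasoning
      a-periodic : iter par (suc (m + k)) a ≡ a
      a-periodic = begin
        iter par (suc (m + k)) a   ≡⟨ cong (λ j → iter par j a) (sym (+-suc m k)) ⟩
        iter par (m + suc k) a     ≡⟨ iter-+ par m (suc k) a ⟩
        iter par m (iter par (suc k) a) ≡⟨ cong (iter par m) ak≡b ⟩
        iter par m b               ≡⟨ bm≡a ⟩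
        a                          ∎
      a≡d : a ≡ d
      a≡d = periodic-fixed par (m + k) (proj₁ (reach a)) a-periodic par-d (proj₂ (reach a))

  climb : ∀ {x a b i j} → i ≤ j → iter par i x ≡ a → iter par j x ≡ b → Desc G a b
  climb {x} {i = i} {j} i≤j xi≡a xj≡b = j ∸ i , (begin
    iter par (j ∸ i) _              ≡⟨ cong (iter par (j ∸ i)) (sym xi≡a) ⟩
    iter par (j ∸ i) (iter par i x) ≡⟨ sym (iter-+ par (j ∸ i) i x) ⟩
    iter par (j ∸ i + i) x          ≡⟨ cong (λ l → iter par l x) (m∸n+n≡m i≤j) ⟩
    iter par j x                    ≡⟨ xj≡b ⟩
    _                               ∎)
    where open ≡-Reasoning

  Desc-comparable : ∀ {x a b} → Desc G x a → Desc G x b → Desc G a b ⊎ Desc G b a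
  Desc-comparable (k , xk≡a) (k′ , xk′≡b) with ≤-total k k′
  ... | inj₁ k≤k′ = inj₁ (climb k≤k′ xk≡a xk′≡b)
  ... | inj₂ k′≤k = inj₂ (climb k′≤k xk′≡b xk≡a)

  siblings-incomparable : ∀ {c c′ w} → TreeArc G c w → TreeArc G c′ w → Desc G c c′ → c ≡ c′
  siblings-incomparable _ _ (zero , c≡c′) = c≡c′
  siblings-incomparable {c} {c′} {w} (_ , pc≡w) (c′≢d , pc′≡w) (suc j , cj≡c′) =
    ⊥-elim (par-moves c′≢d (trans pc′≡w w≡c′))
    where
      w-below-c′ : Desc G w c′
      w-below-c′ = j , trans (cong (iter par j) (sym pc≡w)) (trans (iter-swap par j c) cj≡c′)
      w≡c′ : w ≡ c′
      w≡c′ = Desc-antisym w-below-c′ (1 , pc′≡w)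

  siblings-disjoint : ∀ {x c c′ w} → TreeArc G c w → TreeArc G c′ w →
                      Desc G x c → Desc G x c′ → c ≡ c′
  siblings-disjoint cw c′w xc xc′ with Desc-comparable xc xc′
  ... | inj₁ cc′ = siblings-incomparable cw c′w cc′
  ... | inj₂ c′c = sym (siblings-incomparable c′w cw c′c)

  stays-at-root : ∀ {y v} → y ≡ d → par y ≡ v → y ≡ v
  stays-at-root y≡d py≡v = trans y≡d (trans (sym par-d) (trans (cong par (sym y≡d)) py≡v))

  desc-child : ∀ {x v} → Desc G x v → x ≡ v ⊎ Σ V (λ c → TreeArc G c v × Desc G x c)
  desc-child (k , xk≡v) = last-step k xk≡v
    where
      last-step : ∀ {x v} k → iter par k x ≡ v → x ≡ v ⊎ Σ V (λ c → TreeArc G c v × Desc G x c)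
      last-step zero x≡v = inj₁ x≡v
      last-step {x} {v} (suc k) p[xk]≡v with iter par k x ≟ d
      ... | yes xk≡d = last-step k (stays-at-root xk≡d p[xk]≡v)
      ... | no xk≢d = inj₂ (iter par k x , (xk≢d , p[xk]≡v) , (k , refl))

  tree-path : ∀ (A : List (Arc G)) {x y} → Desc G x y → x ≡ y ⊎ TransClosure (Step G A) x y
  tree-path A (zero , x≡y) = inj₁ x≡y
  tree-path A {x} {y} (suc k , p[xk]≡y) with iter par k x ≟ d | tree-path A (k , refl)
  ... | yes xk≡d | path =
    subst (λ z → x ≡ z ⊎ TransClosure (Step G A) x z) (stays-at-root xk≡d p[xk]≡y) path
  ... | no xk≢d | inj₁ x≡xk = inj₂ [ inj₁ (subst (_≢ d) (sym x≡xk) xk≢d , trans (cong par x≡xk) p[xk]≡y) ]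
  ... | no xk≢d | inj₂ path = inj₂ (path ∷ʳ inj₁ (xk≢d , p[xk]≡y))

  is-child? : ∀ v → Decidable (λ c → TreeArc G c v)
  is-child? v c = ¬? (c ≟ d) ×-dec (par c ≟ v)

  child-in : ∀ {c v} → TreeArc G c v → c ∈ children G v
  child-in {c} {v} cv = ∈-filter⁺ (is-child? v) (∈-allFin c) cv

  child-out : ∀ {c v} → c ∈ children G v → TreeArc G c v
  child-out {v = v} c∈ = proj₂ (∈-filter⁻ (is-child? v) {xs = allFin n} c∈)

  children-unique : ∀ v → Unique (children G v)
  children-unique v = Unique.filter⁺ (is-child? v) (Unique.allFin⁺ n)

  mutual
    dfs-sound : ∀ {v Lv x} → DFS G v Lv → x ∈ Lv → Desc G x v
    dfs-sound (visit p s) (here refl) = 0 , refl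
    dfs-sound (visit p s) (there x∈) with seq-sound s x∈
    ... | c , c∈cs , xc = Desc-trans xc (tree-arc-desc (child-out (∈-resp-↭ p c∈cs)))

    seq-sound : ∀ {cs Ls x} → DFSSeq G cs Ls → x ∈ Ls → Σ V (λ c → c ∈ cs × Desc G x c)
    seq-sound (_∷_ {L = L₁} t s) x∈ with ∈-++⁻ L₁ x∈
    ... | inj₁ x∈L₁ = _ , here refl , dfs-sound t x∈L₁
    ... | inj₂ x∈Ls with seq-sound s x∈Ls
    ...   | c , c∈cs , xc = c , there c∈cs , xc

  mutual
    dfs-complete : ∀ {v Lv x} → DFS G v Lv → Desc G x v → x ∈ Lv
    dfs-complete (visit p s) xv with desc-child xv
    ... | inj₁ refl = here refl
    ... | inj₂ (c , cv , xc) = there (seq-complete s (∈-resp-↭ (↭-sym p) (child-in cv)) xc)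

    seq-complete : ∀ {cs Ls c x} → DFSSeq G cs Ls → c ∈ cs → Desc G x c → x ∈ Ls
    seq-complete (t ∷ s) (here refl) xc = ∈-++⁺ˡ (dfs-complete t xc)
    seq-complete (_∷_ {L = L₁} t s) (there c∈cs) xc = ∈-++⁺ʳ L₁ (seq-complete s c∈cs xc)

  mutual
    -- a DFS lists every vertex once: v is not its own proper descendant, and the
    -- subtrees of distinct children are disjoint
    dfs-unique : ∀ {v Lv} → DFS G v Lv → Unique Lv
    dfs-unique {v} (visit {cs} {L} p s) =
      ¬Any⇒All¬ L v∉L ∷ seq-unique s cs-unique (λ c∈cs → child-out (∈-resp-↭ p c∈cs))
      where
        cs-unique : Unique cs
        cs-unique = Unique-resp-↭ (setoid V) (↭⇒↭ₛ (↭-sym p)) (children-unique v)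
        v∉L : v ∉ L
        v∉L v∈L with seq-sound s v∈L
        ... | c , c∈cs , vc = tree-arc-proper cv (Desc-antisym (tree-arc-desc cv) vc)
          where cv = child-out (∈-resp-↭ p c∈cs)

    seq-unique : ∀ {cs Ls w} → DFSSeq G cs Ls → Unique cs → (∀ {c} → c ∈ cs → TreeArc G c w) →
                 Unique Ls
    seq-unique [] _ _ = []
    seq-unique (_∷_ {L = L₁} {Ls = Ls} t s) (c∉cs ∷ cs-unique) parent =
      Unique.++⁺ (dfs-unique t) (seq-unique s cs-unique (parent ∘ there)) disjoint
      where
        disjoint : ∀ {x} → ¬ (x ∈ L₁ × x ∈ Ls)
        disjoint (x∈t , x∈s) with seq-sound s x∈s
        ... | c′ , c′∈cs , xc′ = All.lookup c∉cs c′∈cs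
          (siblings-disjoint (parent (here refl)) (parent (there c′∈cs)) (dfs-sound t x∈t) xc′)

  record Block (L : List V) (u : V) : Set where
    field
      pre sub post : List V
      split        : L ≡ pre ++ sub ++ post
      dfs          : DFS G u sub

  mutual
    dfs-block : ∀ {v Lv u} → DFS G v Lv → u ∈ Lv → Block Lv u
    dfs-block t@(visit _ _) (here refl) = record
      { pre = [] ; sub = _ ; post = [] ; split = sym (++-identityʳ _) ; dfs = t }
    dfs-block {v} (visit p s) (there u∈) = record
      { pre = v ∷ pre ; sub = sub ; post = post ; split = cong (v ∷_) split ; dfs = dfs }
      where open Block (seq-block s u∈)

    seq-block : ∀ {cs Ls u} → DFSSeq G cs Ls → u ∈ Ls → Block Ls u
    seq-block (_∷_ {L = L₁} {Ls = Ls} t s) u∈ with ∈-++⁻ L₁ u∈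
    ... | inj₁ u∈L₁ = record
      { pre = pre ; sub = sub ; post = post ++ Ls ; dfs = dfs
      ; split = trans (cong (_++ Ls) split)
                      (trans (++-assoc pre (sub ++ post) Ls) (cong (pre ++_) (++-assoc sub post Ls))) }
      where open Block (dfs-block t u∈L₁)
    ... | inj₂ u∈Ls = record
      { pre = L₁ ++ pre ; sub = sub ; post = post ; dfs = dfs
      ; split = trans (cong (L₁ ++_) split) (sym (++-assoc L₁ pre (sub ++ post))) }
      where open Block (seq-block s u∈Ls)

  Edge : V → V → Set
  Edge u v = (u , v) ∈ E ⊎ (v , u) ∈ E

  edge-proper : ∀ {u v} → Edge u v → u ≢ v
  edge-proper (inj₁ uv∈E) = noLoop uv∈E
  edge-proper (inj₂ vu∈E) u≡v = noLoop vu∈E (sym u≡v)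

  arc-origin : ∀ {R A u v} → OrientAll G R A → (u , v) ∈ A → Edge u v × R u v
  arc-origin or uv∈A with pointwise-∈ or uv∈A
  ... | _ , e∈E , inj₁ (refl , r) = inj₁ e∈E , r
  ... | _ , e∈E , inj₂ (refl , r) = inj₂ e∈E , r

  orientation-feasible : ∀ {R A} → OrientAll G R A → Acyclic G A → Feasible G A
  orientation-feasible or acyclic = (λ uv∈A → proj₁ (arc-origin or uv∈A)) , acyclic

  Covered : List (Arc G) → V → Set
  Covered A u = Any (λ a → proj₁ a ≡ u) A

  arc-covers : ∀ {A u v} → (u , v) ∈ A → Covered A u
  arc-covers = Any.map λ { refl → refl }

  oriented-arc : ∀ {R A e} → OrientAll G R A → e ∈ E → Σ (Arc G) (λ a → a ∈ A × Oriented G R e a)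
  oriented-arc or e∈E = pointwise-∈ (Pointwise.symmetric (λ r → r) or) e∈E

  covers-or-reverse : ∀ {R A u v} → OrientAll G R A → Edge u v → Covered A u ⊎ R v u
  covers-or-reverse or (inj₁ uv∈E) with oriented-arc or uv∈E
  ... | _ , a∈A , inj₁ (refl , _) = inj₁ (arc-covers a∈A)
  ... | _ , _   , inj₂ (refl , r) = inj₂ r
  covers-or-reverse or (inj₂ vu∈E) with oriented-arc or vu∈E
  ... | _ , _   , inj₁ (refl , r) = inj₂ r
  ... | _ , a∈A , inj₂ (refl , _) = inj₁ (arc-covers a∈A)

  module Preorder (L : List V) (dfsL : DFS G d L) where
    open Position (_≟_ {n})

    listed : ∀ x → x ∈ L
    listed x = dfs-complete dfsL (reach x)

    L-unique : Unique L
    L-unique = dfs-unique dfsL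

    rank : V → ℕ
    rank x = pos x L

    before-rank : ∀ {u v} → Before G L u v → rank u < rank v
    before-rank (P , Q , split , v∈Q) = before-pos P Q L-unique split v∈Q

    block : ∀ u → Block L u
    block u = dfs-block dfsL (listed u)

    ancestor-before : ∀ {u v} → Desc G u v → u ≢ v → Before G L v u
    ancestor-before {u} {v} uv u≢v = from-block (block v)
      where
        from-block : Block L v → Before G L v u
        from-block record { pre = P ; post = Q ; split = split ; dfs = t@(visit {L = S} _ _) }
          with dfs-complete t uv
        ... | here u≡v = ⊥-elim (u≢v u≡v)
        ... | there u∈S = P , S ++ Q , split , ∈-++⁺ˡ u∈S

    ancestor-rank : ∀ {u v} → Desc G u v → u ≢ v → rank v < rank u
    ancestor-rank uv u≢v = before-rank (ancestor-before uv u≢v)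

    module BlockPositions {u} (b : Block L u) where
      open Block b

      split′ : L ≡ (pre ++ sub) ++ post
      split′ = trans split (sym (++-assoc pre sub post))

      start≤ : ∀ {x} → x ∈ sub → length pre ≤ rank x
      start≤ {x} x∈ = subst (λ l → length pre ≤ pos x l) (sym split)
        (pos-suffix pre (sub ++ post) (subst Unique split L-unique) (∈-++⁺ˡ x∈))

      <end : ∀ {x} → x ∈ sub → rank x < length (pre ++ sub)
      <end {x} x∈ = subst (λ l → pos x l < length (pre ++ sub)) (sym split′)
        (pos-prefix (pre ++ sub) post (∈-++⁺ʳ pre x∈))

      end≤ : ∀ {x} → x ∉ sub → length pre ≤ rank x → length (pre ++ sub) ≤ rank x
      end≤ {x} x∉ start≤x with ∈-++⁻ pre (subst (x ∈_) split (listed x))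
      ... | inj₁ x∈pre = ⊥-elim (<⇒≱ (subst (λ l → pos x l < length pre) (sym split)
                                        (pos-prefix pre (sub ++ post) x∈pre)) start≤x)
      ... | inj₂ x∈rest with ∈-++⁻ sub x∈rest
      ...   | inj₁ x∈sub  = ⊥-elim (x∉ x∈sub)
      ...   | inj₂ x∈post = subst (λ l → length (pre ++ sub) ≤ pos x l) (sym split′)
                              (pos-suffix (pre ++ sub) post (subst Unique split′ L-unique) x∈post)

    -- end u: the position just after the block of the subtree of u
    end : V → ℕ
    end u = length (Block.pre (block u) ++ Block.sub (block u))

    self-in-block : ∀ u → u ∈ Block.sub (block u)
    self-in-block u = dfs-complete (Block.dfs (block u)) (0 , refl)

    -- the subtree of u lies inside that of its ancestor v, so it ends no later
    end-mono : ∀ {u v} → Desc G u v → end u ≤ end v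
    end-mono {u} {v} uv =
      block-end pre sub post L-unique split below-end-v
                (≤-trans (start≤ (self-in-block u)) (<⇒≤ (below-end-v (self-in-block u))))
      where
        open Block (block u)
        open BlockPositions (block u)
        below-end-v : ∀ {x} → x ∈ sub → rank x < end v
        below-end-v x∈ = BlockPositions.<end (block v)
          (dfs-complete (Block.dfs (block v)) (Desc-trans (dfs-sound dfs x∈) uv))

    -- for a cross edge uv with u earlier, the subtree of u is finished before v
    cross-end : ∀ {u v} → IsCross G u v → rank u < rank v → end u < end v
    cross-end {u} {v} cross u<v = ≤-<-trans end-u≤rank-v (<end-v (self-in-block v))
      where
        open BlockPositions (block u)
        open BlockPositions (block v) using () renaming (<end to <end-v)
        v∉sub-u : v ∉ Block.sub (block u)
        v∉sub-u v∈ = cross (inj₂ (dfs-sound (Block.dfs (block u)) v∈))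
        end-u≤rank-v : end u ≤ rank v
        end-u≤rank-v = end≤ v∉sub-u (≤-trans (start≤ (self-in-block u)) (<⇒≤ u<v))

    -- Feasibility of B→ ∪ C← : every step of T ∪ B→ ∪ C← goes to an earlier vertex.
    bwd-step : ∀ {A u v} → OrientAll G (RuleBwd G L) A → Step G A u v → rank v < rank u
    bwd-step or (inj₁ tree) = ancestor-rank (tree-arc-desc tree) (tree-arc-proper tree)
    bwd-step or (inj₂ uv∈A) with arc-origin or uv∈A
    ... | edge , inj₁ (_ , uv)     = ancestor-rank uv (edge-proper edge)
    ... | _    , inj₂ (_ , before) = before-rank before

    bwd-feasible : ∀ {A} → OrientAll G (RuleBwd G L) A → Feasible G A
    bwd-feasible {A} or = orientation-feasible or
      (Rank.rank-acyclic (Step G A) (λ a b → b < a) rank (λ ab bc → <-trans bc ab) (bwd-step or)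
                         (<-irrefl refl))

    -- Feasibility of B→ ∪ C→ : every step increases (end , position) in the
    -- lexicographic order with the position compared in reverse.
    _⋖_ : ℕ × ℕ → ℕ × ℕ → Set
    _⋖_ = ×-Lex _≡_ _<_ _>_

    ⋖-trans : ∀ {a b c} → a ⋖ b → b ⋖ c → a ⋖ c
    ⋖-trans = ×-transitive {_<₁_ = _<_} {_<₂_ = _>_} isEquivalence (resp₂ _<_) <-trans
                           (λ a>b b>c → <-trans b>c a>b)

    ⋖-irrefl : ∀ {a} → ¬ a ⋖ a
    ⋖-irrefl = ×-irreflexive {_<₁_ = _<_} {_<₂_ = _>_} <-irrefl (λ a≡b → <-irrefl (sym a≡b)) (refl , refl)

    key : V → ℕ × ℕ
    key u = end u , rank u

    -- towards an ancestor, end does not drop, and if it stays the position drops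
    ancestor-key : ∀ {u v} → Desc G u v → u ≢ v → key u ⋖ key v
    ancestor-key uv u≢v with m≤n⇒m<n∨m≡n (end-mono uv)
    ... | inj₁ end< = inj₁ end<
    ... | inj₂ end≡ = inj₂ (end≡ , ancestor-rank uv u≢v)

    fwd-step : ∀ {A u v} → OrientAll G (RuleFwd G L) A → Step G A u v → key u ⋖ key v
    fwd-step or (inj₁ tree) = ancestor-key (tree-arc-desc tree) (tree-arc-proper tree)
    fwd-step or (inj₂ uv∈A) with arc-origin or uv∈A
    ... | edge , inj₁ (_ , uv)         = ancestor-key uv (edge-proper edge)
    ... | _    , inj₂ (cross , before) = inj₁ (cross-end cross (before-rank before))

    fwd-feasible : ∀ {A} → OrientAll G (RuleFwd G L) A → Feasible G A
    fwd-feasible {A} or = orientation-feasible or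
      (Rank.rank-acyclic (Step G A) _⋖_ key ⋖-trans (fwd-step or) ⋖-irrefl)

    -- A feasible solution cannot contain u → v when both rules orient uv as v → u:
    -- for a back edge the tree path v ⇝ u closes a cycle, and for a cross edge
    -- the two rules would put u both before and after v.
    both-reversed-impossible : ∀ {A u v} → Acyclic G A → (u , v) ∈ A → u ≢ v →
                  RuleFwd G L v u → RuleBwd G L v u → ⊥
    both-reversed-impossible {A} acyclic uv∈A u≢v (inj₁ (_ , vu)) _ with tree-path A vu
    ... | inj₁ v≡u  = u≢v (sym v≡u)
    ... | inj₂ path = acyclic _ (path ∷ʳ inj₂ uv∈A)
    both-reversed-impossible acyclic uv∈A u≢v (inj₂ (cross , _)) (inj₁ (_ , vu)) = cross (inj₁ vu)
    both-reversed-impossible acyclic uv∈A u≢v (inj₂ (_ , v-before-u)) (inj₂ (_ , u-before-v)) =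
      <-asym (before-rank v-before-u) (before-rank u-before-v)

    covered-by-candidates : ∀ {A₁ A₂ A} → OrientAll G (RuleFwd G L) A₁ → OrientAll G (RuleBwd G L) A₂ →
                            Feasible G A → ∀ {u} → Covered A u → Covered A₁ u ⊎ Covered A₂ u
    covered-by-candidates or₁ or₂ (from-edges , acyclic) covered with find covered
    ... | (_ , v) , uv∈A , refl with from-edges uv∈A
    ...   | edge with covers-or-reverse or₁ edge | covers-or-reverse or₂ edge
    ...     | inj₁ c₁ | _       = inj₁ c₁
    ...     | inj₂ _  | inj₁ c₂ = inj₂ c₂
    ...     | inj₂ r₁ | inj₂ r₂ = ⊥-elim (both-reversed-impossible acyclic uv∈A (edge-proper edge) r₁ r₂)

  coveredCount-∪ : ∀ {A A₁ A₂} → (∀ {u} → Covered A u → Covered A₁ u ⊎ Covered A₂ u) →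
                   coveredCount G A ≤ coveredCount G A₁ + coveredCount G A₂
  coveredCount-∪ {A} {A₁} {A₂} cover =
    count-∪ (covered? A) (covered? A₁) (covered? A₂) cover (allFin n)
    where
      covered? : ∀ A → Decidable (Covered A)
      covered? A u = any? (λ a → proj₁ a ≟ u) A

module _ {n : ℕ} (G : Instance n) (A₁ A₂ : List (Arc G)) where

  better-choice : better G A₁ A₂ ≡ A₁ ⊎ better G A₁ A₂ ≡ A₂
  better-choice with coveredCount G A₂ ≤ᵇ coveredCount G A₁
  ... | true  = inj₁ refl
  ... | false = inj₂ refl

  better-max : coveredCount G A₁ ≤ coveredCount G (better G A₁ A₂) ×
               coveredCount G A₂ ≤ coveredCount G (better G A₁ A₂)
  better-max with coveredCount G A₂ ≤ᵇ coveredCount G A₁ in test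
  ... | true  = ≤-refl , ≤ᵇ⇒≤ c₂ c₁ (subst T (sym test) tt)
    where c₁ = coveredCount G A₁ ; c₂ = coveredCount G A₂
  ... | false = <⇒≤ (≰⇒> (λ c₂≤c₁ → subst T test (≤⇒≤ᵇ c₂≤c₁))) , ≤-refl

theorem1 : ∀ {n : ℕ} (G : Instance n) (L : List (Fin n)) → DFS G (Instance.d G) L →
    ∀ (A₁ A₂ : List (Arc G)) → OrientAll G (RuleFwd G L) A₁ → OrientAll G (RuleBwd G L) A₂ →
    Feasible G (better G A₁ A₂) ×
      (∀ (A : List (Arc G)) → Feasible G A → coveredCount G A ≤ 2 * coveredCount G (better G A₁ A₂))
theorem1 G L dfsL A₁ A₂ or₁ or₂ = better-feasible , half-approximation
  where
    open Tree G
    open Preorder L dfsL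

    better-feasible : Feasible G (better G A₁ A₂)
    better-feasible with better-choice G A₁ A₂
    ... | inj₁ is-A₁ = subst (Feasible G) (sym is-A₁) (fwd-feasible or₁)
    ... | inj₂ is-A₂ = subst (Feasible G) (sym is-A₂) (bwd-feasible or₂)

    half-approximation : ∀ A → Feasible G A → coveredCount G A ≤ 2 * coveredCount G (better G A₁ A₂)
    half-approximation A feasible = begin
      coveredCount G A                       ≤⟨ coveredCount-∪ (covered-by-candidates or₁ or₂ feasible) ⟩
      coveredCount G A₁ + coveredCount G A₂  ≤⟨ +-mono-≤ (proj₁ best-max) (proj₂ best-max) ⟩
      best + best                            ≡⟨ cong (best +_) (sym (+-identityʳ best)) ⟩
      2 * best                               ∎
      where
        open ≤-Reasoning
        best = coveredCount G (better G A₁ A₂)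
        best-max = better-max G A₁ A₂
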